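{- Let $G$ be a finite tree with at least $2$ vertices. Then a minimum connecting transition set of $G$ has size exactly $|V(G)|-2$.
   Context: All graphs are finite, simple and undirected. A walk in $G$ is a sequence $(v_1,\dots,v_k)$ of vertices with $v_iv_{i+1}\in E(G)$ for all $i\le k-1$. A transition is a set of two distinct adjacent edges $\{ab,bc\}$ with $a\neq c$, written $abc$. Given a set $T$ of transitions of $G$, a walk $(v_1,\dots,v_k)$ is $T$-compatible if for every $i\in[1,k-2]$, either $v_iv_{i+1}v_{i+2}\in T$ or $v_i=v_{i+2}$ (a walk with at most two vertices is always $T$-compatible). $G$ is $T$-connected (and $T$ is a connecting transition set of $G$) if for all vertices $u,v$ of $G$ there is a $T$-compatible walk from $u$ to $v$. A minimum connecting transition set is one of minimum cardinality. -}

module Defs where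

open import Data.Nat using (ℕ; _≤_; _∸_)
open import Data.Fin using (Fin)
open import Data.List using (List; []; _∷_; length)
open import Data.List.Relation.Unary.All using (All)
open import Data.List.Relation.Unary.Any using (Any)
open import Data.List.Relation.Unary.AllPairs using (AllPairs)
open import Data.List.Relation.Unary.Linked using (Linked)
open import Data.List.Relation.Unary.Unique.Propositional using (Unique)
open import Data.Product using (Σ; _×_; ∃; ∃-syntax)
open import Data.Sum using (_⊎_)
open import Data.Unit using (⊤)
open import Relation.Nullary using (¬_)
open import Relation.Binary.PropositionalEquality using (_≡_; _≢_)

record Graph (n : ℕ) : Set₁ where
  field
    Adj     : Fin n → Fin n → Set
    sym     : ∀ {u v} → Adj u v → Adj v u
    irrefl  : ∀ {u} → ¬ Adj u u
open Graph public

module _ {n : ℕ} (G : Graph n) where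

  V : Set
  V = Fin n

  lastOf : V → List V → V
  lastOf x []       = x
  lastOf _ (y ∷ ys) = lastOf y ys

  IsWalk : List V → Set
  IsWalk = Linked (Adj G)

  Connected : Set
  Connected = ∀ (u v : V) → ∃[ vs ] (IsWalk (u ∷ vs) × lastOf u vs ≡ v)

  IsCycle : V → List V → Set
  IsCycle x xs = Unique (x ∷ xs) × IsWalk (x ∷ xs) × 3 ≤ length (x ∷ xs)
                 × Adj G (lastOf x xs) x

  Acyclic : Set
  Acyclic = ∀ (x : V) (xs : List V) → ¬ IsCycle x xs

  IsTree : Set
  IsTree = Connected × Acyclic

  -- A transition abc = {ab, bc} is represented by the triple (a , b , c);
  -- the triples (a , b , c) and (c , b , a) denote the same transition.
  Triple : Set
  Triple = V × V × V

  IsTransition : Triple → Set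
  IsTransition (a Data.Product., b Data.Product., c) = Adj G a b × Adj G b c × a ≢ c

  SameTr : Triple → Triple → Set
  SameTr (a Data.Product., b Data.Product., c) t =
    (t ≡ (a Data.Product., b Data.Product., c)) ⊎ (t ≡ (c Data.Product., b Data.Product., a))

  -- A set of transitions: a duplicate-free (up to reversal) list of transitions.
  -- Its cardinality is its length.
  TransitionSet : List Triple → Set
  TransitionSet T = All IsTransition T × AllPairs (λ s t → ¬ SameTr s t) T

  InT : List Triple → V → V → V → Set
  InT T a b c = Any (SameTr (a Data.Product., b Data.Product., c)) T

  Compatible : List Triple → List V → Set
  Compatible T (a ∷ xs@(b ∷ c ∷ _)) = (InT T a b c ⊎ a ≡ c) × Compatible T xs
  Compatible T _ = ⊤

  TConnected : List Triple → Set
  TConnected T = ∀ (u v : V) →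
    ∃[ vs ] (IsWalk (u ∷ vs) × Compatible T (u ∷ vs) × lastOf u vs ≡ v)

  ConnectingTS : List Triple → Set
  ConnectingTS T = TransitionSet T × TConnected T

  MinConnectingSize : ℕ → Set
  MinConnectingSize k =
    (∃[ T ] (ConnectingTS T × length T ≡ k)) ×
    (∀ T → ConnectingTS T → k ≤ length T)

-- Root the tree at a leaf r with neighbour s.  For the upper bound, take for every vertex v of depth
-- at least 2 the transition (v, parent v, grandparent v): every vertex then walks compatibly up to r,
-- and two such walks can be glued at the leaf r, where the walk turns back.  For the lower bound, view
-- the n - 1 edges of the tree as the vertices of an auxiliary graph in which a transition abc joins ab
-- and bc.  A compatible walk from v to r moves along such joins (or repeats an edge), ends with the
-- edge sr, and crosses every tree edge between v and r; so the auxiliary graph is connected and has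
-- at least n - 2 edges.
module Submission where

open import Defs
open import Data.Nat using (ℕ; zero; suc; _+_; _≤_; _<_; _∸_; z≤n; s≤s; _≤?_)
open import Data.Nat.Properties
  using (≤-trans; ≤-reflexive; ≤-antisym; ≤-pred; m≤n⇒m≤1+n; 1+n≰n; <-irrefl; <-asym; <-trans; ∸-monoˡ-≤; module ≤-Reasoning)
open import Data.Fin using (Fin; zero; suc)
open import Data.Fin.Properties using (_≟_; injective⇒≤)
open import Data.List using (List; []; _∷_; _∷ʳ_; length; _++_; reverse; [_]; map; filter; allFin; lookup)
open import Data.List.Properties using (reverse-++; unfold-reverse; length-map; length-filter; filter-notAll; length-tabulate)
open import Data.List.Extrema.Nat using (argmax; f[xs]≤f[argmax])
open import Data.List.Relation.Unary.All as All using (All; []; _∷_)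
import Data.List.Relation.Unary.All.Properties as All
open import Data.List.Relation.Unary.Any as Any using (Any; here; there; any?)
import Data.List.Relation.Unary.Any.Properties as Any
open import Data.List.Relation.Unary.AllPairs using (AllPairs; []; _∷_)
import Data.List.Relation.Unary.AllPairs.Properties as AllPairs
open import Data.List.Relation.Unary.Linked using ([-]; _∷_)
import Data.List.Relation.Unary.Linked as Linked
open import Data.List.Relation.Unary.Unique.Propositional using (Unique)
open import Data.List.Relation.Unary.Unique.Propositional.Properties using (allFin⁺)
open import Data.List.Membership.Propositional using (_∈_; _∉_)
open import Data.List.Membership.Propositional.Properties using (∈-filter⁺; ∈-allFin)
import Data.List.Membership.DecPropositional as DecMembership
open import Data.List.Relation.Binary.Subset.Propositional using (_⊆_)
open import Data.Product using (_×_; _,_; proj₁; proj₂; ∃-syntax)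
open import Data.Sum as Sum using (_⊎_; inj₁; inj₂; swap)
open import Function using (id)
open import Data.Empty using (⊥; ⊥-elim)
open import Data.Unit using (tt)
open import Relation.Nullary using (¬_; yes; no)
open import Relation.Nullary.Decidable using (_×-dec_)
open import Relation.Unary using (Decidable)
open import Relation.Binary.PropositionalEquality as ≡ using (_≡_; _≢_; refl; cong; cong₂; subst; subst₂; trans)
open import Relation.Binary.Construct.Closure.ReflexiveTransitive using (Star; ε; _◅_)

module _ {a p q} {A : Set a} {P : A → Set p} {Q : A → Set q}
         (P? : Decidable P) (Q? : Decidable Q) (P⇒Q : ∀ {x} → P x → Q x) where

  length-filter-mono : ∀ xs → length (filter P? xs) ≤ length (filter Q? xs)
  length-filter-mono []       = z≤n
  length-filter-mono (x ∷ xs) with P? x | Q? x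
  ... | yes _  | yes _  = s≤s (length-filter-mono xs)
  ... | yes px | no ¬qx = ⊥-elim (¬qx (P⇒Q px))
  ... | no _   | yes _  = m≤n⇒m≤1+n (length-filter-mono xs)
  ... | no _   | no _   = length-filter-mono xs

  length-filter-strict : ∀ xs → Any (λ x → Q x × ¬ P x) xs → length (filter P? xs) < length (filter Q? xs)
  length-filter-strict (x ∷ xs) (here (qx , ¬px)) with P? x | Q? x
  ... | yes px | _      = ⊥-elim (¬px px)
  ... | no _   | yes _  = s≤s (length-filter-mono xs)
  ... | no _   | no ¬qx = ⊥-elim (¬qx qx)
  length-filter-strict (x ∷ xs) (there any) with P? x | Q? x
  ... | yes _  | yes _  = s≤s (length-filter-strict xs any)
  ... | yes px | no ¬qx = ⊥-elim (¬qx (P⇒Q px))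
  ... | no _   | yes _  = m≤n⇒m≤1+n (length-filter-strict xs any)
  ... | no _   | no _   = length-filter-strict xs any

filter-notAll₂ : ∀ {a p} {A : Set a} {P : A → Set p} (P? : Decidable P) {x y : A} xs →
                 x ≢ y → x ∈ xs → y ∈ xs → ¬ P x → ¬ P y → suc (suc (length (filter P? xs))) ≤ length xs
filter-notAll₂ {P = P} P? {x} {y} (z ∷ zs) x≢y x∈ y∈ ¬px ¬py with P? z
... | yes pz = s≤s (filter-notAll₂ P? zs x≢y (Any.tail (rejected ¬px) x∈) (Any.tail (rejected ¬py) y∈) ¬px ¬py)
  where
    rejected : ∀ {w} → ¬ P w → w ≢ z
    rejected ¬pw refl = ¬pw pz
... | no _ with x∈
...   | there x∈zs = s≤s (filter-notAll P? zs (Any.map (λ { refl → ¬px }) x∈zs))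
...   | here refl  = s≤s (filter-notAll P? zs (Any.map (λ { refl → ¬py }) (Any.tail (λ y≡x → x≢y (≡.sym y≡x)) y∈)))

allPairs-restrict : ∀ {a p r s} {A : Set a} {P : A → Set p} {R : A → A → Set r} {S : A → A → Set s} →
                    (∀ {x y} → P x → P y → R x y → S x y) → ∀ {xs} → All P xs → AllPairs R xs → AllPairs S xs
allPairs-restrict f []         []         = []
allPairs-restrict f (px ∷ pxs) (rx ∷ rxs) =
  All.zipWith (λ (py , r) → f px py r) (pxs , rx) ∷ allPairs-restrict f pxs rxs

covering⇒≤length : ∀ {k} (xs : List (Fin k)) → (∀ i → i ∈ xs) → k ≤ length xs
covering⇒≤length xs cover = injective⇒≤ {f = λ i → Any.index (cover i)} λ {i} {j} same →
  trans (Any.lookup-index (cover i)) (trans (cong (lookup xs) same) (≡.sym (Any.lookup-index (cover j))))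

-- Grow a connected vertex set one neighbour at a time: each new vertex brings a new internal edge.
module SpanningEdges {k : ℕ} (E : List (Fin k × Fin k)) where
  open DecMembership (_≟_ {k}) using (_∈?_)

  Joined : Fin k → Fin k → Set
  Joined x y = Any (λ e → e ≡ (x , y) ⊎ e ≡ (y , x)) E

  Inside : List (Fin k) → Fin k × Fin k → Set
  Inside vs (a , b) = a ∈ vs × b ∈ vs

  inside? : ∀ vs → Decidable (Inside vs)
  inside? vs (a , b) = a ∈? vs ×-dec b ∈? vs

  internal : List (Fin k) → List (Fin k × Fin k)
  internal vs = filter (inside? vs) E

  BoundedByEdges : List (Fin k) → Set
  BoundedByEdges vs = length vs ≤ suc (length (internal vs))

  bounded-∷ : ∀ {vs x z} → BoundedByEdges vs → z ∈ vs → x ∉ vs → Joined x z → BoundedByEdges (x ∷ vs)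
  bounded-∷ {vs} {x} {z} bounded z∈ x∉ joined =
    s≤s (≤-trans bounded (length-filter-strict (inside? vs) (inside? (x ∷ vs)) widen E (Any.map new joined)))
    where
      widen : ∀ {e} → Inside vs e → Inside (x ∷ vs) e
      widen (a∈ , b∈) = there a∈ , there b∈
      new : ∀ {e} → e ≡ (x , z) ⊎ e ≡ (z , x) → Inside (x ∷ vs) e × ¬ Inside vs e
      new (inj₁ refl) = (here refl , there z∈) , λ (x∈ , _) → x∉ x∈
      new (inj₂ refl) = (there z∈ , here refl) , λ (_ , x∈) → x∉ x∈

  bounded-extend : ∀ {x z} → Star Joined x z → ∀ {vs} → BoundedByEdges vs → z ∈ vs →
                   ∃[ ws ] (BoundedByEdges ws × x ∈ ws × vs ⊆ ws)
  bounded-extend ε bounded z∈ = _ , bounded , z∈ , λ v∈ → v∈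
  bounded-extend {x} (joined ◅ rest) bounded z∈ with bounded-extend rest bounded z∈
  ... | ws , bounded′ , y∈ , ⊆ws with x ∈? ws
  ...   | yes x∈ = ws , bounded′ , x∈ , ⊆ws
  ...   | no x∉  = x ∷ ws , bounded-∷ bounded′ y∈ x∉ joined , here refl , λ v∈ → there (⊆ws v∈)

  bounded-cover : ∀ b → (∀ v → Star Joined v b) → ∀ us → ∃[ ws ] (BoundedByEdges ws × b ∈ ws × us ⊆ ws)
  bounded-cover b reach []       = [ b ] , s≤s z≤n , here refl , λ ()
  bounded-cover b reach (u ∷ us) with bounded-cover b reach us
  ... | ws , bounded , b∈ , ⊆ws with bounded-extend (reach u) bounded b∈
  ...   | ws′ , bounded′ , u∈ , ⊆ws′ =
    ws′ , bounded′ , ⊆ws′ b∈ , λ { (here refl) → u∈ ; (there v∈) → ⊆ws′ (⊆ws v∈) }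

  connected⇒≤ : ∀ b → (∀ v → Star Joined v b) → k ≤ suc (length E)
  connected⇒≤ b reach with bounded-cover b reach (allFin k)
  ... | ws , bounded , _ , all∈ =
    ≤-trans (covering⇒≤length ws (λ i → all∈ (∈-allFin i))) (≤-trans bounded (s≤s (length-filter (inside? ws) E)))

module WalkProperties {n : ℕ} (G : Graph n) where

  Path : Fin n → Fin n → List (Fin n) → Set
  Path x y xs = Unique (x ∷ xs) × IsWalk G (x ∷ xs) × lastOf G x xs ≡ y

  lastOf-∈ : ∀ x y ys → lastOf G x (y ∷ ys) ∈ y ∷ ys
  lastOf-∈ x y []       = here refl
  lastOf-∈ x y (z ∷ zs) = there (lastOf-∈ y z zs)

  lastOf-++ : ∀ x xs ys → lastOf G x (xs ++ ys) ≡ lastOf G (lastOf G x xs) ys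
  lastOf-++ x []       ys = refl
  lastOf-++ x (y ∷ xs) ys = lastOf-++ y xs ys

  walk-++ : ∀ x xs ys → IsWalk G (x ∷ xs) → IsWalk G (lastOf G x xs ∷ ys) → IsWalk G (x ∷ xs ++ ys)
  walk-++ x []       ys _        w′ = w′
  walk-++ x (y ∷ xs) ys (xy ∷ w) w′ = xy ∷ walk-++ y xs ys w w′

  walk-reverse : ∀ x xs → IsWalk G (x ∷ xs) →
                 ∃[ ys ] (reverse (x ∷ xs) ≡ lastOf G x xs ∷ ys × IsWalk G (lastOf G x xs ∷ ys)
                          × lastOf G (lastOf G x xs) ys ≡ x)
  walk-reverse x []       _        = [] , refl , [-] , refl
  walk-reverse x (y ∷ xs) (xy ∷ w) with walk-reverse y xs w
  ... | ys , rev≡ , w′ , last≡ =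
    ys ∷ʳ x ,
    trans (unfold-reverse x (y ∷ xs)) (cong (_∷ʳ x) rev≡) ,
    walk-++ _ ys [ x ] w′ (subst (λ z → IsWalk G (z ∷ [ x ])) (≡.sym last≡) (sym G xy ∷ [-])) ,
    lastOf-++ _ ys [ x ]

  path-tail : ∀ {x y a} as → Path x y (a ∷ as) → Path a y as
  path-tail as (_ ∷ u , _ ∷ w , last≡) = u , w , last≡

  path-∷⇒≢ : ∀ {x y b} bs → Path x y (b ∷ bs) → x ≢ y
  path-∷⇒≢ {x} {b = b} bs (x∉ ∷ _ , _ , last≡) refl =
    All.lookup x∉ (subst (_∈ b ∷ bs) last≡ (lastOf-∈ x b bs)) refl

  path-suffix : ∀ {y b} x xs → Path x y xs → b ∈ x ∷ xs → ∃[ bs ] (Path b y bs × b ∷ bs ⊆ x ∷ xs)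
  path-suffix x xs       path (here refl) = xs , path , λ c∈ → c∈
  path-suffix x (x′ ∷ xs) path (there b∈) with path-suffix x′ xs (path-tail xs path) b∈
  ... | bs , path′ , ⊆xs = bs , path′ , λ c∈ → there (⊆xs c∈)

  path-suffix-avoiding : ∀ {x y b} xs → Path x y xs → b ∈ xs → ∃[ bs ] (Path b y bs × All (x ≢_) (b ∷ bs))
  path-suffix-avoiding (x′ ∷ xs) path@(x∉ ∷ _ , _) b∈ with path-suffix x′ xs (path-tail xs path) b∈
  ... | bs , path′ , ⊆xs = bs , path′ , All.tabulate (λ c∈ → All.lookup x∉ (⊆xs c∈))

  walk⇒path : ∀ x xs → IsWalk G (x ∷ xs) → ∃[ zs ] (Path x (lastOf G x xs) zs × x ∷ zs ⊆ x ∷ xs)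
  walk⇒path x []       _        = [] , ([] ∷ [] , [-] , refl) , λ c∈ → c∈
  walk⇒path x (y ∷ ys) (xy ∷ w) with walk⇒path y ys w
  ... | zs , path@(u , w′ , last≡) , ⊆ys with any? (x ≟_) (y ∷ zs)
  ...   | yes x∈ = let bs , path′ , ⊆zs = path-suffix y zs path x∈ in
                   bs , path′ , λ c∈ → there (⊆ys (⊆zs c∈))
  ...   | no x∉  = y ∷ zs , (All.¬Any⇒All¬ _ x∉ ∷ u , xy ∷ w′ , last≡) ,
                   λ { (here refl) → here refl ; (there c∈) → there (⊆ys c∈) }

  module _ (acyclic : Acyclic G) where

    no-closing-walk : ∀ {v a b} xs → IsWalk G (a ∷ xs) → lastOf G a xs ≡ b → a ≢ b →
                      All (v ≢_) (a ∷ xs) → Adj G v a → Adj G b v → ⊥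
    no-closing-walk {v} {a} {b} xs w last≡ a≢b v∉ va bv with walk⇒path a xs w
    ... | zs , (u , w′ , last≡′) , ⊆xs =
      acyclic v (a ∷ zs) (All.tabulate (λ c∈ → All.lookup v∉ (⊆xs c∈)) ∷ u , va ∷ w′ ,
                          long zs (trans last≡′ last≡) , subst (λ z → Adj G z v) (≡.sym (trans last≡′ last≡)) bv)
      where
        long : ∀ zs → lastOf G a zs ≡ b → 3 ≤ length (v ∷ a ∷ zs)
        long []      a≡b = ⊥-elim (a≢b a≡b)
        long (_ ∷ _) _   = s≤s (s≤s (s≤s z≤n))

    path-unique : ∀ {v y} xs ys → Path v y xs → Path v y ys → xs ≡ ys
    path-unique []       []       _    _    = refl
    path-unique []       (b ∷ ys) (_ , _ , v≡y) path = ⊥-elim (path-∷⇒≢ ys path v≡y)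
    path-unique (a ∷ xs) []       path (_ , _ , v≡y) = ⊥-elim (path-∷⇒≢ xs path v≡y)
    path-unique {v} (a ∷ xs) (b ∷ ys) pathˣ@(v∉a ∷ _ , va ∷ wa , lastᵃ) pathʸ@(v∉b ∷ _ , vb ∷ wb , lastᵇ)
      with a ≟ b
    ... | yes refl = cong (a ∷_) (path-unique xs ys (path-tail xs pathˣ) (path-tail ys pathʸ))
    ... | no a≢b with walk-reverse b ys wb
    ...   | ys′ , rev≡ , w′ , last′ = ⊥-elim (no-closing-walk (xs ++ ys′) walk last≡ a≢b v∉ va (sym G vb))
      where
        same-end : lastOf G b ys ≡ lastOf G a xs
        same-end = trans lastᵇ (≡.sym lastᵃ)
        walk : IsWalk G (a ∷ xs ++ ys′)
        walk = walk-++ a xs ys′ wa (subst (λ z → IsWalk G (z ∷ ys′)) same-end w′)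
        last≡ : lastOf G a (xs ++ ys′) ≡ b
        last≡ = trans (lastOf-++ a xs ys′) (subst (λ z → lastOf G z ys′ ≡ b) same-end last′)
        v∉ : All (v ≢_) (a ∷ xs ++ ys′)
        v∉ = All.++⁺ v∉a (All.tabulate λ c∈ → All.lookup v∉b (Any.reverse⁻ (subst (_ ∈_) (≡.sym rev≡) (there c∈))))

  Leaf : Fin n → Set
  Leaf m = ∀ {a b} → Adj G a m → Adj G m b → a ≡ b

  module _ (T : List (Triple G)) where

    InT-reverse : ∀ {a b c} → InT G T a b c → InT G T c b a
    InT-reverse = Any.map swap

    compatible-++ : ∀ p a b q → Compatible G T (p ++ a ∷ b ∷ []) → Compatible G T (a ∷ b ∷ q) →
                    Compatible G T (p ++ a ∷ b ∷ q)
    compatible-++ []              a b q _        c = c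
    compatible-++ (x ∷ [])        a b q (t , _)  c = t , c
    compatible-++ (x ∷ y ∷ [])    a b q (t , c₁) c = t , compatible-++ (y ∷ []) a b q c₁ c
    compatible-++ (x ∷ y ∷ z ∷ p) a b q (t , c₁) c = t , compatible-++ (y ∷ z ∷ p) a b q c₁ c

    compatible-reverse : ∀ xs → Compatible G T xs → Compatible G T (reverse xs)
    compatible-reverse []                 _ = tt
    compatible-reverse (a ∷ [])           _ = tt
    compatible-reverse (a ∷ b ∷ [])       _ = tt
    compatible-reverse (a ∷ b ∷ c ∷ rest) (t , cs) =
      subst (Compatible G T) (≡.sym (reverse-++ (a ∷ b ∷ c ∷ []) rest))
        (compatible-++ (reverse rest) c b (a ∷ [])
          (subst (Compatible G T) (reverse-++ (b ∷ c ∷ []) rest) (compatible-reverse (b ∷ c ∷ rest) cs))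
          (Sum.map InT-reverse ≡.sym t , tt))

    -- at a leaf the concatenated walk turns back, which is always allowed
    compatible-++-leaf : ∀ x vs ws → IsWalk G (x ∷ vs) → Compatible G T (x ∷ vs) →
                         IsWalk G (lastOf G x vs ∷ ws) → Compatible G T (lastOf G x vs ∷ ws) →
                         Leaf (lastOf G x vs) → Compatible G T (x ∷ vs ++ ws)
    compatible-++-leaf x []           ws       _        _        _        c _    = c
    compatible-++-leaf x (y ∷ [])     []       _        _        _        _ _    = tt
    compatible-++-leaf x (y ∷ [])     (w ∷ ws) (xy ∷ _) _        (yw ∷ _) c leaf = inj₂ (leaf xy yw) , c
    compatible-++-leaf x (y ∷ z ∷ vs) ws       (_ ∷ w)  (t , cs) w′       c leaf =
      t , compatible-++-leaf y (z ∷ vs) ws w cs w′ c leaf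

    TWalk : Fin n → Fin n → Set
    TWalk x y = ∃[ vs ] (IsWalk G (x ∷ vs) × Compatible G T (x ∷ vs) × lastOf G x vs ≡ y)

    TWalk-sym : ∀ {x y} → TWalk x y → TWalk y x
    TWalk-sym {x} (vs , w , c , refl) with walk-reverse x vs w
    ... | ys , rev≡ , w′ , last≡ = ys , w′ , subst (Compatible G T) rev≡ (compatible-reverse (x ∷ vs) c) , last≡

    TWalk-trans-leaf : ∀ {x m y} → Leaf m → TWalk x m → TWalk m y → TWalk x y
    TWalk-trans-leaf {x} leaf (vs , w , c , refl) (ws , w′ , c′ , refl) =
      vs ++ ws , walk-++ x vs ws w w′ , compatible-++-leaf x vs ws w c w′ c′ leaf , lastOf-++ x vs ws

module RootedTree {n : ℕ} (G : Graph n) (connected : Connected G) (acyclic : Acyclic G) (ρ : Fin n) where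
  open WalkProperties G

  pathToRoot : ∀ v → ∃[ xs ] Path v ρ xs
  pathToRoot v with connected v ρ
  ... | xs , w , refl = let zs , path , _ = walk⇒path v xs w in zs , path

  up : Fin n → List (Fin n)
  up v = proj₁ (pathToRoot v)

  up-path : ∀ v → Path v ρ (up v)
  up-path v = proj₂ (pathToRoot v)

  headOr : Fin n → List (Fin n) → Fin n
  headOr v []      = v
  headOr _ (a ∷ _) = a

  parent : Fin n → Fin n
  parent v = headOr v (up v)

  depth : Fin n → ℕ
  depth v = length (up v)

  up-root : up ρ ≡ []
  up-root = path-unique acyclic (up ρ) [] (up-path ρ) ([] ∷ [] , [-] , refl)

  parent-root : parent ρ ≡ ρ
  parent-root = cong (headOr ρ) up-root

  depth-root : depth ρ ≡ 0
  depth-root = cong length up-root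

  up-∷ : ∀ {v a as} → up v ≡ a ∷ as → parent v ≡ a × up a ≡ as
  up-∷ {v} {a} {as} up≡ =
    cong (headOr v) up≡ ,
    path-unique acyclic (up a) as (up-path a) (path-tail as (subst (Path v ρ) up≡ (up-path v)))

  up-parent : ∀ v → v ≢ ρ → up v ≡ parent v ∷ up (parent v)
  up-parent v v≢ρ with up v in up≡
  ... | []     = ⊥-elim (v≢ρ (proj₂ (proj₂ (subst (Path v ρ) up≡ (up-path v)))))
  ... | a ∷ as = cong (a ∷_) (≡.sym (proj₂ (up-∷ up≡)))

  adj-parent : ∀ v → v ≢ ρ → Adj G v (parent v)
  adj-parent v v≢ρ = Linked.head (subst (λ xs → IsWalk G (v ∷ xs)) (up-parent v v≢ρ) (proj₁ (proj₂ (up-path v))))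

  depth-parent : ∀ v → v ≢ ρ → depth v ≡ suc (depth (parent v))
  depth-parent v v≢ρ = cong length (up-parent v v≢ρ)

  depth-parent-< : ∀ v → v ≢ ρ → depth (parent v) < depth v
  depth-parent-< v v≢ρ = ≤-reflexive (≡.sym (depth-parent v v≢ρ))

  depth>0⇒≢root : ∀ {v} → 0 < depth v → v ≢ ρ
  depth>0⇒≢root 0<depth refl with () ← subst (0 <_) depth-root 0<depth

  ∈up⇒≢root : ∀ {v b} → b ∈ up v → v ≢ ρ
  ∈up⇒≢root {b = b} b∈ refl = Any.¬Any[] (subst (b ∈_) up-root b∈)

  adjacent⇒parent : ∀ {a b} → Adj G a b → (a ≢ ρ × parent a ≡ b) ⊎ (b ≢ ρ × parent b ≡ a)
  adjacent⇒parent {a} {b} ab with any? (b ≟_) (a ∷ up a) | up-path a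
  ... | yes (here refl) | _ = ⊥-elim (irrefl G ab)
  ... | yes (there b∈)  | _ with path-suffix-avoiding (up a) (up-path a) b∈
  ...   | bs , (u , w , last≡) , a∉ =
    inj₁ (∈up⇒≢root b∈ , cong (headOr a) (path-unique acyclic (up a) (b ∷ bs) (up-path a) (a∉ ∷ u , ab ∷ w , last≡)))
  adjacent⇒parent {a} {b} ab | no b∉ | u , w , last≡ =
    inj₂ (path-∷⇒≢ (up a) path , cong (headOr b) (path-unique acyclic (up b) (a ∷ up a) (up-path b) path))
    where
      path : Path b ρ (a ∷ up a)
      path = All.¬Any⇒All¬ _ b∉ ∷ u , sym G ab ∷ w , last≡

  parent-not-mutual : ∀ {x y} → x ≢ ρ → parent x ≡ y → parent y ≢ x
  parent-not-mutual {x} {y} x≢ρ px≡y py≡x with y ≟ ρ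
  ... | yes refl = x≢ρ (trans (≡.sym py≡x) parent-root)
  ... | no y≢ρ   = <-asym (subst (λ z → depth z < depth x) px≡y (depth-parent-< x x≢ρ))
                          (subst (λ z → depth z < depth y) py≡x (depth-parent-< y y≢ρ))

  deepest-is-leaf : ∀ ℓ → ℓ ≢ ρ → (∀ w → depth w ≤ depth ℓ) → ∀ w → Adj G ℓ w → w ≡ parent ℓ
  deepest-is-leaf ℓ ℓ≢ρ deepest w ℓw with adjacent⇒parent ℓw
  ... | inj₁ (_ , pℓ≡w)   = ≡.sym pℓ≡w
  ... | inj₂ (w≢ρ , pw≡ℓ) = ⊥-elim (1+n≰n (subst (_≤ depth ℓ) depth-w (deepest w)))
    where
      depth-w : depth w ≡ suc (depth ℓ)
      depth-w = trans (depth-parent w w≢ρ) (cong (λ p → suc (depth p)) pw≡ℓ)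

leaf-exists : ∀ {m} (G : Graph (suc (suc m))) → IsTree G → ∃[ r ] ∃[ s ] (Adj G r s × (∀ w → Adj G r w → w ≡ s))
leaf-exists {m} G (connected , acyclic) = ℓ , parent ℓ , adj-parent ℓ ℓ≢root , deepest-is-leaf ℓ ℓ≢root deepest
  where
    open RootedTree G connected acyclic zero
    ℓ : Fin (suc (suc m))
    ℓ = argmax depth zero (allFin _)
    deepest : ∀ w → depth w ≤ depth ℓ
    deepest w = All.lookup (f[xs]≤f[argmax] {f = depth} zero (allFin _)) (∈-allFin w)
    ℓ≢root : ℓ ≢ zero
    ℓ≢root = depth>0⇒≢root (≤-trans (≤-trans (s≤s z≤n) (depth-parent-< (suc zero) (λ ()))) (deepest (suc zero)))

module LeafRooted {n : ℕ} (G : Graph n) (connected : Connected G) (acyclic : Acyclic G)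
                  (r s : Fin n) (rs : Adj G r s) (r-leaf : ∀ w → Adj G r w → w ≡ s) where
  open WalkProperties G
  open RootedTree G connected acyclic r

  s≢r : s ≢ r
  s≢r refl = irrefl G rs

  leaf-r : Leaf r
  leaf-r ar rb = trans (r-leaf _ (sym G ar)) (≡.sym (r-leaf _ rb))

  parent-s : parent s ≡ r
  parent-s with adjacent⇒parent rs
  ... | inj₁ (r≢r , _)  = ⊥-elim (r≢r refl)
  ... | inj₂ (_ , ps≡r) = ps≡r

  up-s : up s ≡ r ∷ []
  up-s = trans (up-parent s s≢r) (cong₂ _∷_ parent-s (trans (cong up parent-s) up-root))

  Deep : Fin n → Set
  Deep v = 2 ≤ depth v

  deep? : Decidable Deep
  deep? v = 2 ≤? depth v

  deep⇒≢r : ∀ {v} → Deep v → v ≢ r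
  deep⇒≢r deep = depth>0⇒≢root (≤-trans (s≤s z≤n) deep)

  deep⇒parent≢r : ∀ {v} → Deep v → parent v ≢ r
  deep⇒parent≢r {v} deep = depth>0⇒≢root (≤-pred (subst (2 ≤_) (depth-parent v (deep⇒≢r deep)) deep))

  depth-grandparent-< : ∀ {v} → Deep v → depth (parent (parent v)) < depth v
  depth-grandparent-< {v} deep =
    <-trans (depth-parent-< (parent v) (deep⇒parent≢r deep)) (depth-parent-< v (deep⇒≢r deep))

  transitionAt : Fin n → Triple G
  transitionAt v = v , parent v , parent (parent v)

  transitionAt-valid : ∀ {v} → Deep v → IsTransition G (transitionAt v)
  transitionAt-valid {v} deep =
    adj-parent v (deep⇒≢r deep) , adj-parent (parent v) (deep⇒parent≢r deep) ,
    λ v≡ → <-irrefl (cong depth (≡.sym v≡)) (depth-grandparent-< deep)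

  transitionAt-distinct : ∀ {u v} → Deep u → Deep v → u ≢ v → ¬ SameTr G (transitionAt u) (transitionAt v)
  transitionAt-distinct _ _ u≢v (inj₁ same) = u≢v (≡.sym (cong proj₁ same))
  transitionAt-distinct {u} {v} deepᵘ deepᵛ _ (inj₂ reversed) =
    <-asym (subst (λ z → depth z < depth u) (≡.sym (cong proj₁ reversed)) (depth-grandparent-< deepᵘ))
           (subst (λ z → depth z < depth v) (cong (λ t → proj₂ (proj₂ t)) reversed) (depth-grandparent-< deepᵛ))

  deepVertices : List (Fin n)
  deepVertices = filter deep? (allFin n)

  T₀ : List (Triple G)
  T₀ = map transitionAt deepVertices

  T₀-transitionSet : TransitionSet G T₀
  T₀-transitionSet =
    All.map⁺ (All.map transitionAt-valid (All.all-filter deep? (allFin n))) ,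
    AllPairs.map⁺ (allPairs-restrict transitionAt-distinct (All.all-filter deep? (allFin n))
                                     (AllPairs.filter⁺ deep? (allFin⁺ n)))

  length-T₀ : 2 + length T₀ ≤ n
  length-T₀ = begin
    2 + length T₀           ≡⟨ cong (2 +_) (length-map transitionAt deepVertices) ⟩
    2 + length deepVertices ≤⟨ filter-notAll₂ deep? (allFin n) (λ r≡s → s≢r (≡.sym r≡s))
                                 (∈-allFin r) (∈-allFin s) ¬deep-r ¬deep-s ⟩
    length (allFin n)       ≡⟨ length-tabulate id ⟩
    n                       ∎
    where
      open ≤-Reasoning
      ¬deep-r : ¬ Deep r
      ¬deep-r deep with () ← subst (2 ≤_) depth-root deep
      ¬deep-s : ¬ Deep s
      ¬deep-s deep with s≤s () ← subst (λ xs → 2 ≤ length xs) up-s deep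

  transitionAt-∈ : ∀ {v} → Deep v → InT G T₀ v (parent v) (parent (parent v))
  transitionAt-∈ deep = Any.map⁺ (Any.map (λ { refl → inj₁ refl }) (∈-filter⁺ deep? (∈-allFin _) deep))

  up-compatible : ∀ v → Compatible G T₀ (v ∷ up v)
  up-compatible v = go v (up v) refl
    where
      go : ∀ v xs → up v ≡ xs → Compatible G T₀ (v ∷ xs)
      go v []           _   = tt
      go v (y ∷ [])     _   = tt
      go v (y ∷ z ∷ zs) up≡ =
        let pv≡y , up-y≡ = up-∷ up≡
            py≡z , _     = up-∷ up-y≡
            deep         = subst (λ xs → 2 ≤ length xs) (≡.sym up≡) (s≤s (s≤s z≤n))
        in inj₁ (subst₂ (InT G T₀ v) pv≡y (trans (cong parent pv≡y) py≡z) (transitionAt-∈ deep)) ,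
           go y (z ∷ zs) up-y≡

  up-TWalk : ∀ v → TWalk T₀ v r
  up-TWalk v = up v , proj₁ (proj₂ (up-path v)) , up-compatible v , proj₂ (proj₂ (up-path v))

  T₀-connected : TConnected G T₀
  T₀-connected u v = TWalk-trans-leaf T₀ leaf-r (up-TWalk u) (TWalk-sym T₀ (up-TWalk v))

  -- child x y is the endpoint of the edge xy farther from r; it identifies the edges of the tree
  -- with the vertices other than r.
  child : Fin n → Fin n → Fin n
  child x y with parent x ≟ y
  ... | yes _ = x
  ... | no _  = y

  child-parent : ∀ {x y} → parent x ≡ y → child x y ≡ x
  child-parent {x} {y} px≡y with parent x ≟ y
  ... | yes _   = refl
  ... | no px≢y = ⊥-elim (px≢y px≡y)

  child-not-parent : ∀ {x y} → parent x ≢ y → child x y ≡ y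
  child-not-parent {x} {y} px≢y with parent x ≟ y
  ... | yes px≡y = ⊥-elim (px≢y px≡y)
  ... | no _     = refl

  child-sym : ∀ {x y} → Adj G x y → child x y ≡ child y x
  child-sym xy with adjacent⇒parent xy
  ... | inj₁ (x≢r , px≡y) = trans (child-parent px≡y) (≡.sym (child-not-parent (parent-not-mutual x≢r px≡y)))
  ... | inj₂ (y≢r , py≡x) = trans (child-not-parent (parent-not-mutual y≢r py≡x)) (≡.sym (child-parent py≡x))

  -- Vertex r stands for no tree edge; the extra pair (s , r) attaches it at the cost of one edge.
  module Connecting (T : List (Triple G)) (T-connected : TConnected G T) where
    edgePair : Triple G → Fin n × Fin n
    edgePair (a , b , c) = child a b , child b c

    open SpanningEdges ((s , r) ∷ map edgePair T)

    Reaches : Fin n → Set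
    Reaches v = Star Joined v s

    transition-reaches : ∀ {x y z} → Adj G x y → Adj G y z → InT G T x y z ⊎ x ≡ z →
                         Reaches (child y z) → Reaches (child x y)
    transition-reaches xy yz (inj₂ refl) reach = subst Reaches (≡.sym (child-sym xy)) reach
    transition-reaches {x} {y} {z} xy yz (inj₁ t∈T) reach = there (Any.map⁺ (Any.map joins t∈T)) ◅ reach
      where
        joins : ∀ {t} → SameTr G (x , y , z) t →
                edgePair t ≡ (child x y , child y z) ⊎ edgePair t ≡ (child y z , child x y)
        joins (inj₁ refl) = inj₁ refl
        joins (inj₂ refl) = inj₂ (cong₂ _,_ (child-sym (sym G yz)) (≡.sym (child-sym xy)))

    ancestors-reach : ∀ {x y} → Adj G x y → Reaches (child x y) →
                      (∀ {v} → v ≢ r → v ∈ y ∷ up y → Reaches v) → ∀ {v} → v ≢ r → v ∈ x ∷ up x → Reaches v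
    ancestors-reach {x} {y} xy reach-xy reach-y {v} v≢r v∈ with adjacent⇒parent xy
    ... | inj₂ (y≢r , py≡x) =
      reach-y v≢r (there (subst (v ∈_) (≡.sym (trans (up-parent y y≢r) (cong (λ p → p ∷ up p) py≡x))) v∈))
    ... | inj₁ (x≢r , px≡y) with subst (λ xs → v ∈ x ∷ xs) (trans (up-parent x x≢r) (cong (λ p → p ∷ up p) px≡y)) v∈
    ...   | here refl = subst Reaches (child-parent px≡y) reach-xy
    ...   | there v∈′ = reach-y v≢r v∈′

    -- a walk to r crosses every edge of the tree path from its start to r
    walk-reaches : ∀ x y rest → IsWalk G (x ∷ y ∷ rest) → Compatible G T (x ∷ y ∷ rest) → lastOf G y rest ≡ r →
                   Reaches (child x y) × (∀ {v} → v ≢ r → v ∈ x ∷ up x → Reaches v)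
    walk-reaches x y [] (xy ∷ _) _ refl with r-leaf x (sym G xy)
    ... | refl = subst Reaches (≡.sym (child-parent parent-s)) ε , ancestors-s
      where
        ancestors-s : ∀ {v} → v ≢ r → v ∈ s ∷ up s → Reaches v
        ancestors-s _ (here refl) = ε
        ancestors-s v≢r (there v∈) with subst (_ ∈_) up-s v∈
        ... | here v≡r = ⊥-elim (v≢r v≡r)
    walk-reaches x y (z ∷ rest) (xy ∷ w) (t , c) last≡ with walk-reaches y z rest w c last≡
    ... | reach-yz , reach-y = reach-xy , ancestors-reach xy reach-xy reach-y
      where
        reach-xy : Reaches (child x y)
        reach-xy = transition-reaches xy (Linked.head w) t reach-yz

    reaches : ∀ v → Reaches v
    reaches v with v ≟ r
    ... | yes refl = here (inj₂ refl) ◅ ε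
    ... | no v≢r with T-connected v r
    ...   | []       , _ , _ , v≡r   = ⊥-elim (v≢r v≡r)
    ...   | y ∷ rest , w , c , last≡ = proj₂ (walk-reaches v y rest w c last≡) v≢r (here refl)

    n≤2+length : n ≤ 2 + length T
    n≤2+length = subst (λ k → n ≤ 2 + k) (length-map edgePair T) (connected⇒≤ s reaches)

  minConnectingSize : MinConnectingSize G (n ∸ 2)
  minConnectingSize =
    (T₀ , (T₀-transitionSet , T₀-connected) ,
     cong (_∸ 2) (≤-antisym length-T₀ (Connecting.n≤2+length T₀ T₀-connected))) ,
    λ T (_ , T-connected) → ∸-monoˡ-≤ 2 (Connecting.n≤2+length T T-connected)

lemma1 : (n : ℕ) (G : Graph n) → IsTree G → 2 ≤ n → MinConnectingSize G (n ∸ 2)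
lemma1 zero          G _ ()
lemma1 (suc zero)    G _ (s≤s ())
lemma1 (suc (suc m)) G tree@(connected , acyclic) _ =
  let r , s , rs , r-leaf = leaf-exists G tree in LeafRooted.minConnectingSize G connected acyclic r s rs r-leaf
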